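{- For every positive integer $g$, the number of sets $A$ of genus $g$ that are $m$-extensions for some integer $m>1$ is exactly $2^{g-1}$.
   Context: $\mathbb N$ is the set of positive integers, $\mathbb N_0=\mathbb N\cup\{0\}$, $[a,b]=\{x\in\mathbb Z: a\le x\le b\}$. For an integer $m>1$, an $m$-extension is a finite set $A\subset\mathbb N$ containing $[1,m-1]$ that admits a partition $A=A_0\cup A_1\cup\dots\cup A_t$ for some $t\in\mathbb N_0$, where $A_0=[1,m-1]$ and $A_{i+1}\subseteq m+A_i$ for all $i$. The genus of an $m$-extension $A$ is $\#A$. The sets counted are those in the union over all $m>1$ of the $m$-extensions of genus $g$. -}

module Defs where

open import Data.Nat using (ℕ; _+_; _≤_; _<_)
open import Data.List using (List; length)
open import Data.List.Membership.Propositional using (_∈_)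
open import Data.List.Relation.Unary.All using (All)
open import Data.List.Relation.Unary.Linked using (Linked)
open import Data.Product using (Σ; _×_; ∃; ∃-syntax)
open import Function.Bundles using (_⇔_)
open import Relation.Binary.PropositionalEquality using (_≡_)

-- A finite set of positive integers, represented canonically as a
-- strictly increasing list of positive naturals (so list equality is set
-- equality, and length is cardinality).
IsFinSet : List ℕ → Set
IsFinSet A = All (1 ≤_) A × Linked _<_ A

IsMExtension : ℕ → List ℕ → Set
IsMExtension m A =
  (∀ x → 1 ≤ x → x < m → x ∈ A) ×
  Σ ℕ λ t → Σ (ℕ → List ℕ) λ P →
    (∀ x → (x ∈ P 0) ⇔ ((1 ≤ x) × (x < m))) ×
    (∀ i → i < t → ∀ x → x ∈ P (Data.Nat.suc i) → ∃[ y ] (y ∈ P i × x ≡ m + y)) ×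
    (∀ x → (x ∈ A) ⇔ (∃[ i ] (i ≤ t × x ∈ P i))) ×
    (∀ i j x → i ≤ t → j ≤ t → x ∈ P i → x ∈ P j → i ≡ j)

IsExtension : List ℕ → Set
IsExtension A = ∃[ m ] (2 ≤ m × IsMExtension m A)

genus : List ℕ → ℕ
genus = length

-- An m-extension A is determined by m and by the number c_r ≥ 1 of its elements in each
-- residue class r ∈ [1, m-1]: closure under x ↦ x ∸ m makes that class the column
-- r, r + m, …, r + (c_r - 1) m, and m is the least positive integer missing from A.
-- Hence the m-extensions of genus g, over all m > 1, correspond bijectively to the
-- compositions (c_1, …, c_{m-1}) of g, and there are 2^(g-1) of those.
module Submission where

open import Defs
open import Data.Nat
open import Data.Nat.Properties
open import Data.Nat.DivMod using (_%_; _/_; [m+kn]%n≡m%n; m<n⇒m%n≡m; m<n⇒m/n≡0; m/n≡0⇒m<n; m/n≢0⇒n≤m; [m∸n]/n≡m/n∸1; m/n≤m)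
open import Data.Nat.ListAction using (sum)
open import Data.Fin as Fin using (Fin; toℕ; fromℕ<)
open import Data.Fin.Properties using (toℕ<n; toℕ-fromℕ<; toℕ-injective)
open import Data.List using (List; []; _∷_; [_]; _++_; length; map; applyUpTo; lookup; filter)
open import Data.List.Properties using (length-++; length-map; length-applyUpTo; lookup-applyUpTo)
open import Data.List.Membership.Propositional using (_∈_; _∉_)
open import Data.List.Membership.Propositional.Properties using (∈-++⁺ˡ; ∈-++⁺ʳ; ∈-++⁻; ∈-map⁺; ∈-map⁻; ∈-applyUpTo⁺; ∈-applyUpTo⁻; ∈-lookup; ∈-filter⁺; ∈-filter⁻)
open import Data.List.Membership.Propositional.Properties.WithK using (unique∧set⇒bag)
open import Data.List.Membership.DecPropositional _≟_ using (_∈?_)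
open import Data.List.Relation.Unary.Any using (here)
open import Data.List.Relation.Unary.All as All using (All; []; _∷_)
import Data.List.Relation.Unary.All.Properties as All
open import Data.List.Relation.Unary.AllPairs as AllPairs using ([]; _∷_)
open import Data.List.Relation.Unary.Linked as Linked using (Linked; []; [-]; _∷_)
open import Data.List.Relation.Unary.Linked.Properties using (Linked⇒AllPairs)
open import Data.List.Relation.Unary.Unique.Propositional using (Unique)
import Data.List.Relation.Unary.Unique.Propositional.Properties as Unique
open import Data.List.Relation.Binary.BagAndSetEquality using (∼bag⇒↭)
open import Data.List.Relation.Binary.Permutation.Propositional using (↭-sym; ↭⇒↭ₛ)
open import Data.List.Relation.Binary.Permutation.Propositional.Properties using (∈-resp-↭; ↭-length)
import Data.List.Relation.Binary.Permutation.Setoid.Properties as Permutationₛ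
open import Data.List.Relation.Binary.Pointwise using (lookup⁻; Pointwise-≡⇒≡)
open import Data.List.Relation.Unary.Sorted.TotalOrder.Properties using (↗↭↗⇒≋)
open import Data.List.Sort ≤-decTotalOrder using (sort; sort-↭; sort-↗)
open import Data.List.Extrema ≤-totalOrder using (max; xs≤max)
open import Data.Product using (Σ; _×_; _,_; proj₁; proj₂; ∃-syntax)
open import Data.Empty using (⊥-elim)
open import Data.Sum using (inj₁; inj₂)
open import Function.Base using (_∘_)
open import Function.Bundles using (_⇔_; mk⇔; Equivalence)
open import Relation.Binary.PropositionalEquality using (_≡_; refl; sym; trans; cong; cong₂; subst; subst₂; setoid; module ≡-Reasoning)
open import Relation.Binary.Definitions using (tri<; tri≈; tri>)
open import Relation.Nullary using (¬_; yes; no)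
open import Relation.Unary using (Decidable)

open Equivalence using (to; from)

quotRem-injective : ∀ {m r r′} j j′ .{{_ : NonZero m}} → r < m → r′ < m →
                    r + j * m ≡ r′ + j′ * m → r ≡ r′ × j ≡ j′
quotRem-injective {m} {r} {r′} j j′ r<m r′<m eq = r≡r′ , j≡j′
  where
  open ≡-Reasoning
  r≡r′ : r ≡ r′
  r≡r′ = begin
    r                  ≡⟨ m<n⇒m%n≡m r<m ⟨
    r % m              ≡⟨ [m+kn]%n≡m%n r j m ⟨
    (r + j * m) % m    ≡⟨ cong (_% m) eq ⟩
    (r′ + j′ * m) % m  ≡⟨ [m+kn]%n≡m%n r′ j′ m ⟩
    r′ % m             ≡⟨ m<n⇒m%n≡m r′<m ⟩
    r′                 ∎
  j≡j′ : j ≡ j′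
  j≡j′ = *-cancelʳ-≡ j j′ m (+-cancelˡ-≡ r _ _ (trans eq (cong (_+ j′ * m) (sym r≡r′))))

n+[m+o]∸m≡n+o : ∀ m n o → n + (m + o) ∸ m ≡ n + o
n+[m+o]∸m≡n+o m n o = trans (+-∸-assoc n (m≤m+n m o)) (cong (n +_) (m+n∸m≡n m o))

m+[n+o]≡n+[m+o] : ∀ m n o → m + (n + o) ≡ n + (m + o)
m+[n+o]≡n+[m+o] m n o = begin
  m + (n + o)  ≡⟨ +-assoc m n o ⟨
  m + n + o    ≡⟨ cong (_+ o) (+-comm m n) ⟩
  n + m + o    ≡⟨ +-assoc n m o ⟩
  n + (m + o)  ∎
  where open ≡-Reasoning

<-⇔-injective : ∀ {a b} → (∀ j → j < a ⇔ j < b) → a ≡ b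
<-⇔-injective {a} {b} h = ≤-antisym (≮⇒≥ λ b<a → <-irrefl refl (to (h b) b<a))
                                     (≮⇒≥ λ a<b → <-irrefl refl (from (h a) a<b))

downClosed-below : ∀ {P : ℕ → Set} → (∀ {j} → P (suc j) → P j) → ∀ {j k} → j ≤ k → P k → P j
downClosed-below down {k = zero}  z≤n pk = pk
downClosed-below down {k = suc k} j≤k pk with m≤n⇒m<n∨m≡n j≤k
... | inj₁ j<k = downClosed-below down (≤-pred j<k) (down pk)
... | inj₂ refl = pk

initialSegment : ∀ (P : ℕ → Set) → Decidable P → (∀ {j} → P (suc j) → P j) →
                 ∀ b → (∀ {j} → P j → j < b) → ∃[ k ] (∀ j → P j ⇔ j < k)
initialSegment P P? down zero    bound = zero , λ j → mk⇔ bound λ ()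
initialSegment P P? down (suc b) bound with P? b
... | yes pb = suc b , λ j → mk⇔ bound λ j<b → downClosed-below down (≤-pred j<b) pb
... | no ¬pb = initialSegment P P? down b λ {j} pj →
                 ≤∧≢⇒< (≤-pred (bound pj)) λ { refl → ¬pb pj }

IsComposition : ℕ → List ℕ → Set
IsComposition g c = All (1 ≤_) c × sum c ≡ g

incrementHead : List ℕ → List ℕ
incrementHead []       = []
incrementHead (k ∷ ks) = suc k ∷ ks

compositions : ℕ → List (List ℕ)
compositions zero            = [ [] ]
compositions (suc zero)      = [ [ 1 ] ]
compositions (suc g@(suc _)) = map incrementHead (compositions g) ++ map (1 ∷_) (compositions g)

length-compositions : ∀ g → length (compositions g) ≡ 2 ^ (g ∸ 1)
length-compositions zero             = refl
length-compositions (suc zero)       = refl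
length-compositions (suc g@(suc g′)) = begin
  length (map incrementHead (compositions g) ++ map (1 ∷_) (compositions g))
    ≡⟨ length-++ (map incrementHead (compositions g)) ⟩
  length (map incrementHead (compositions g)) + length (map (1 ∷_) (compositions g))
    ≡⟨ cong₂ _+_ (length-map incrementHead (compositions g)) (length-map (1 ∷_) (compositions g)) ⟩
  length (compositions g) + length (compositions g)
    ≡⟨ cong (λ n → n + n) (length-compositions g) ⟩
  2 ^ g′ + 2 ^ g′
    ≡⟨ cong (2 ^ g′ +_) (+-identityʳ (2 ^ g′)) ⟨
  2 ^ (suc g ∸ 1) ∎
  where open ≡-Reasoning

positive-sum≡0 : ∀ {c} → All (1 ≤_) c → sum c ≡ 0 → c ≡ []
positive-sum≡0 []              _  = refl
positive-sum≡0 (s≤s z≤n ∷ _) ()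

incrementHead-isComposition : ∀ {g d} → IsComposition (suc g) d →
                              IsComposition (suc (suc g)) (incrementHead d)
incrementHead-isComposition {d = _ ∷ _} (_ ∷ pos , sum≡) = s≤s z≤n ∷ pos , cong suc sum≡

1∷-isComposition : ∀ {g d} → IsComposition g d → IsComposition (suc g) (1 ∷ d)
1∷-isComposition (pos , sum≡) = s≤s z≤n ∷ pos , cong suc sum≡

compositions-isComposition : ∀ g → All (IsComposition g) (compositions g)
compositions-isComposition zero       = ([] , refl) ∷ []
compositions-isComposition (suc zero) = (s≤s z≤n ∷ [] , refl) ∷ []
compositions-isComposition (suc g@(suc _)) =
  All.++⁺ (All.map⁺ (All.map incrementHead-isComposition (compositions-isComposition g)))
          (All.map⁺ (All.map 1∷-isComposition (compositions-isComposition g)))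

∈-compositions⁺ : ∀ g {c} → IsComposition g c → c ∈ compositions g
∈-compositions⁺ zero {[]} _ = here refl
∈-compositions⁺ zero {_ ∷ _} (s≤s z≤n ∷ _ , ())
∈-compositions⁺ (suc zero) {suc zero ∷ cs} (_ ∷ pos , eq)
  rewrite positive-sum≡0 pos (suc-injective eq) = here refl
∈-compositions⁺ (suc zero) {suc (suc k) ∷ cs} (_ , eq) = ⊥-elim (1+n≢0 (suc-injective eq))
∈-compositions⁺ (suc g@(suc _)) {suc (suc k) ∷ cs} (_ ∷ pos , eq) =
  ∈-++⁺ˡ (∈-map⁺ incrementHead (∈-compositions⁺ g (s≤s z≤n ∷ pos , suc-injective eq)))
∈-compositions⁺ (suc g@(suc _)) {suc zero ∷ cs} (_ ∷ pos , eq) =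
  ∈-++⁺ʳ (map incrementHead (compositions g))
         (∈-map⁺ (1 ∷_) (∈-compositions⁺ g (pos , suc-injective eq)))

incrementHead-injective : ∀ {c d} → incrementHead c ≡ incrementHead d → c ≡ d
incrementHead-injective {[]}    {[]}    _    = refl
incrementHead-injective {_ ∷ _} {_ ∷ _} refl = refl

compositions-unique : ∀ g → Unique (compositions g)
compositions-unique zero            = [] ∷ []
compositions-unique (suc zero)      = [] ∷ []
compositions-unique (suc g@(suc _)) =
  Unique.++⁺ (Unique.map⁺ incrementHead-injective (compositions-unique g))
             (Unique.map⁺ (λ { refl → refl }) (compositions-unique g))
             disjoint
  where
  disjoint : ∀ {c} → ¬ (c ∈ map incrementHead (compositions g) × c ∈ map (1 ∷_) (compositions g))
  disjoint (c∈↑ , c∈1∷) with ∈-map⁻ incrementHead c∈↑ | ∈-map⁻ (1 ∷_) c∈1∷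
  ... | d , d∈ , refl | _ , _ , eq with All.lookup (compositions-isComposition g) d∈
  ...   | s≤s z≤n ∷ _ , _ with () ← eq

record Stacked (m : ℕ) (A : List ℕ) : Set where
  field
    base    : ∀ {x} → 1 ≤ x → x < m → x ∈ A
    residue : ∀ {x} → x ∈ A → ∃[ r ] ∃[ j ] (1 ≤ r × r < m × x ≡ r + j * m)
    down    : ∀ {x} → x ∈ A → m ≤ x → x ∸ m ∈ A

  positive : ∀ {x} → x ∈ A → 1 ≤ x
  positive x∈A with r , j , 1≤r , _ , refl ← residue x∈A = ≤-trans 1≤r (m≤m+n r (j * m))

  modulus∉ : m ∉ A
  modulus∉ m∈A with residue m∈A
  ... | r , zero  , _   , r<m , eq = <-irrefl (sym (trans eq (+-identityʳ r))) r<m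
  ... | r , suc j , 1≤r , _   , eq =
    <-irrefl eq (≤-trans (+-monoˡ-≤ m 1≤r) (+-monoʳ-≤ r (m≤m+n m (j * m))))

open Stacked

Stacked-modulus-unique : ∀ {m m′ A} → 1 ≤ m → 1 ≤ m′ → Stacked m A → Stacked m′ A → m ≡ m′
Stacked-modulus-unique {m} {m′} 1≤m 1≤m′ S S′ with <-cmp m m′
... | tri< m<m′ _ _ = ⊥-elim (modulus∉ S (base S′ 1≤m m<m′))
... | tri≈ _ m≡m′ _ = m≡m′
... | tri> _ _ m′<m = ⊥-elim (modulus∉ S′ (base S 1≤m′ m′<m))

IsMExtension⇒Stacked : ∀ {m A} → IsMExtension m A → Stacked m A
IsMExtension⇒Stacked {m} {A} (baseA , t , P , P0⇔ , step , A⇔ , _) = record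
  { base    = λ {x} → baseA x
  ; residue = residue′
  ; down    = down′
  }
  where
  inPart : ∀ i → i ≤ t → ∀ {x} → x ∈ P i → ∃[ r ] (1 ≤ r × r < m × x ≡ r + i * m)
  inPart zero    _   {x} x∈ with 1≤x , x<m ← to (P0⇔ x) x∈ = x , 1≤x , x<m , sym (+-identityʳ x)
  inPart (suc i) i<t {x} x∈ with y , y∈ , refl ← step i i<t x x∈
    with r , 1≤r , r<m , refl ← inPart i (≤-trans (n≤1+n i) i<t) y∈ =
    r , 1≤r , r<m , m+[n+o]≡n+[m+o] m r (i * m)

  residue′ : ∀ {x} → x ∈ A → ∃[ r ] ∃[ j ] (1 ≤ r × r < m × x ≡ r + j * m)
  residue′ {x} x∈A with i , i≤t , x∈ ← to (A⇔ x) x∈A with r , 1≤r , r<m , eq ← inPart i i≤t x∈ =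
    r , i , 1≤r , r<m , eq

  down′ : ∀ {x} → x ∈ A → m ≤ x → x ∸ m ∈ A
  down′ {x} x∈A m≤x with to (A⇔ x) x∈A
  ... | zero  , _   , x∈ = ⊥-elim (<⇒≱ (proj₂ (to (P0⇔ x) x∈)) m≤x)
  ... | suc i , i<t , x∈ with y , y∈ , refl ← step i i<t x x∈ =
    subst (_∈ A) (sym (m+n∸m≡n m y)) (from (A⇔ y) (i , ≤-trans (n≤1+n i) i<t , y∈))

Stacked⇒IsMExtension : ∀ {m A} .{{_ : NonZero m}} → Stacked m A → IsMExtension m A
Stacked⇒IsMExtension {m} {A} S =
  (λ x → base S) , max 0 A , part , part0⇔ , step , A⇔ , disjoint
  where
  part : ℕ → List ℕ
  part i = filter (λ x → x / m ≟ i) A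

  ∈-part⁻ : ∀ {i x} → x ∈ part i → x ∈ A × x / m ≡ i
  ∈-part⁻ {i} = ∈-filter⁻ (λ x → x / m ≟ i)

  ∈-part⁺ : ∀ {x} → x ∈ A → x ∈ part (x / m)
  ∈-part⁺ {x} x∈A = ∈-filter⁺ (λ y → y / m ≟ x / m) x∈A refl

  part0⇔ : ∀ x → x ∈ part 0 ⇔ (1 ≤ x × x < m)
  part0⇔ x = mk⇔ (λ x∈ → let x∈A , x/m≡0 = ∈-part⁻ x∈ in positive S x∈A , m/n≡0⇒m<n x/m≡0)
                 (λ (1≤x , x<m) → subst (x ∈_) (cong part (m<n⇒m/n≡0 x<m)) (∈-part⁺ (base S 1≤x x<m)))

  step : ∀ i → i < max 0 A → ∀ x → x ∈ part (suc i) → ∃[ y ] (y ∈ part i × x ≡ m + y)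
  step i _ x x∈ with x∈A , x/m≡1+i ← ∈-part⁻ x∈ = x ∸ m , y∈ , sym (m+[n∸m]≡n m≤x)
    where
    m≤x : m ≤ x
    m≤x = m/n≢0⇒n≤m λ x/m≡0 → 1+n≢0 (trans (sym x/m≡1+i) x/m≡0)
    y∈ : x ∸ m ∈ part i
    y∈ = subst (x ∸ m ∈_) (cong (part ∘ pred) x/m≡1+i)
           (subst (λ k → x ∸ m ∈ part k) ([m∸n]/n≡m/n∸1 x m) (∈-part⁺ (down S x∈A m≤x)))

  A⇔ : ∀ x → (x ∈ A) ⇔ (∃[ i ] (i ≤ max 0 A × x ∈ part i))
  A⇔ x = mk⇔ (λ x∈A → x / m , ≤-trans (m/n≤m x m) (All.lookup (xs≤max 0 A) x∈A) , ∈-part⁺ x∈A)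
             (λ (i , _ , x∈) → proj₁ (∈-part⁻ x∈))

  disjoint : ∀ i j x → i ≤ max 0 A → j ≤ max 0 A → x ∈ part i → x ∈ part j → i ≡ j
  disjoint i j x _ _ x∈i x∈j = trans (sym (proj₂ (∈-part⁻ x∈i))) (proj₂ (∈-part⁻ x∈j))

column : ℕ → ℕ → ℕ → List ℕ
column m r k = applyUpTo (λ j → r + j * m) k

columns : ℕ → ℕ → List ℕ → List ℕ
columns m r []       = []
columns m r (k ∷ ks) = column m r k ++ columns m (suc r) ks

InColumns : ℕ → ℕ → List ℕ → ℕ → Set
InColumns m r ks x = ∃[ i ] ∃[ j ] (j < lookup ks i × x ≡ r + toℕ i + j * m)

∈-columns⁻ : ∀ {m r ks x} → x ∈ columns m r ks → InColumns m r ks x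
∈-columns⁻ {m} {r} {k ∷ ks} x∈ with ∈-++⁻ (column m r k) x∈
... | inj₁ x∈col with j , j<k , refl ← ∈-applyUpTo⁻ (λ j → r + j * m) x∈col =
  Fin.zero , j , j<k , cong (_+ j * m) (sym (+-identityʳ r))
... | inj₂ x∈cols with i , j , j<ki , refl ← ∈-columns⁻ {m} {suc r} {ks} x∈cols =
  Fin.suc i , j , j<ki , cong (_+ j * m) (sym (+-suc r (toℕ i)))

∈-columns⁺ : ∀ {m r ks x} → InColumns m r ks x → x ∈ columns m r ks
∈-columns⁺ {m} {r} {k ∷ ks} (Fin.zero , j , j<k , refl) =
  ∈-++⁺ˡ (subst (_∈ column m r k) (cong (_+ j * m) (sym (+-identityʳ r)))
                (∈-applyUpTo⁺ (λ j → r + j * m) j<k))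
∈-columns⁺ {m} {r} {k ∷ ks} (Fin.suc i , j , j<ki , refl) =
  ∈-++⁺ʳ (column m r k) (subst (_∈ columns m (suc r) ks) (cong (_+ j * m) (sym (+-suc r (toℕ i))))
                               (∈-columns⁺ {m} {suc r} {ks} (i , j , j<ki , refl)))

length-columns : ∀ m r ks → length (columns m r ks) ≡ sum ks
length-columns m r []       = refl
length-columns m r (k ∷ ks) = begin
  length (column m r k ++ columns m (suc r) ks)
    ≡⟨ length-++ (column m r k) ⟩
  length (column m r k) + length (columns m (suc r) ks)
    ≡⟨ cong₂ _+_ (length-applyUpTo _ k) (length-columns m (suc r) ks) ⟩
  k + sum ks ∎
  where open ≡-Reasoning

column-unique : ∀ m r k .{{_ : NonZero m}} → Unique (column m r k)
column-unique m r k = Unique.applyUpTo⁺₁ _ k λ i<j _ eq →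
  <⇒≢ i<j (*-cancelʳ-≡ _ _ m (+-cancelˡ-≡ r _ _ eq))

columns-unique : ∀ m r ks .{{_ : NonZero m}} → r + length ks ≤ m → Unique (columns m r ks)
columns-unique m r []       _     = []
columns-unique m r (k ∷ ks) bound =
  Unique.++⁺ (column-unique m r k) (columns-unique m (suc r) ks bound′) disjoint
  where
  bound′ : suc r + length ks ≤ m
  bound′ = subst (_≤ m) (+-suc r (length ks)) bound
  disjoint : ∀ {x} → ¬ (x ∈ column m r k × x ∈ columns m (suc r) ks)
  disjoint (x∈col , x∈cols) with j , _ , refl ← ∈-applyUpTo⁻ (λ j → r + j * m) x∈col
                                | i , j′ , _ , eq ← ∈-columns⁻ {m} {suc r} {ks} x∈cols =
    <-irrefl r≡ (s≤s (m≤m+n r (toℕ i)))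
    where
    r≡ : r ≡ suc r + toℕ i
    r≡ = proj₁ (quotRem-injective j j′ (<-≤-trans (s≤s (m≤m+n r (length ks))) bound′)
                                  (<-≤-trans (+-monoʳ-< (suc r) (toℕ<n i)) bound′) eq)

sorted∧unique⇒strictlySorted : ∀ {xs} → Linked _≤_ xs → Unique xs → Linked _<_ xs
sorted∧unique⇒strictlySorted []         _                 = []
sorted∧unique⇒strictlySorted [-]        _                 = [-]
sorted∧unique⇒strictlySorted (x≤y ∷ xs↗) ((x≢y ∷ _) ∷ xs!) =
  ≤∧≢⇒< x≤y x≢y ∷ sorted∧unique⇒strictlySorted xs↗ xs!

strictlySorted-ext : ∀ {xs ys} → Linked _<_ xs → Linked _<_ ys →
                     (∀ x → (x ∈ xs) ⇔ (x ∈ ys)) → xs ≡ ys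
strictlySorted-ext xs↗ ys↗ xs⇔ys =
  Pointwise-≡⇒≡ (↗↭↗⇒≋ ≤-totalOrder (Linked.map <⇒≤ xs↗) (Linked.map <⇒≤ ys↗)
    (↭⇒↭ₛ (∼bag⇒↭ (unique∧set⇒bag (strictlySorted⇒unique xs↗) (strictlySorted⇒unique ys↗)
                                  (xs⇔ys _)))))
  where
  strictlySorted⇒unique : ∀ {zs} → Linked _<_ zs → Unique zs
  strictlySorted⇒unique = AllPairs.map <⇒≢ ∘ Linked⇒AllPairs <-trans

Unique-map⁺ : ∀ {A B : Set} {P : A → Set} {f : A → B} {xs} →
              (∀ {x y} → P x → P y → f x ≡ f y → x ≡ y) → All P xs → Unique xs → Unique (map f xs)
Unique-map⁺ inj []         []          = []
Unique-map⁺ inj (px ∷ pxs) (x∉ ∷ xs!) =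
  All.map⁺ (All.zipWith (λ (x≢y , py) → x≢y ∘ inj px py) (x∉ , pxs)) ∷ Unique-map⁺ inj pxs xs!

extension : List ℕ → List ℕ
extension c = sort (columns (suc (length c)) 1 c)

∈-extension⇔ : ∀ c {x} → (x ∈ extension c) ⇔ InColumns (suc (length c)) 1 c x
∈-extension⇔ c = mk⇔ (∈-columns⁻ {ks = c} ∘ ∈-resp-↭ (sort-↭ _))
                     (∈-resp-↭ (↭-sym (sort-↭ _)) ∘ ∈-columns⁺ {ks = c})

length-extension : ∀ c → length (extension c) ≡ sum c
length-extension c = trans (↭-length (sort-↭ _)) (length-columns _ 1 c)

extension-strictlySorted : ∀ c → Linked _<_ (extension c)
extension-strictlySorted c = sorted∧unique⇒strictlySorted (sort-↗ _)
  (Permutationₛ.Unique-resp-↭ (setoid ℕ) (↭⇒↭ₛ (↭-sym (sort-↭ _))) (columns-unique _ 1 c ≤-refl))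

extension-isFinSet : ∀ c → IsFinSet (extension c)
extension-isFinSet c = All.tabulate member-positive , extension-strictlySorted c
  where
  member-positive : ∀ {x} → x ∈ extension c → 1 ≤ x
  member-positive x∈ with _ , _ , _ , refl ← to (∈-extension⇔ c) x∈ = s≤s z≤n

extension-stacked : ∀ {c} → All (1 ≤_) c → Stacked (suc (length c)) (extension c)
extension-stacked {c} c⁺ = record { base = base′ ; residue = residue′ ; down = down′ }
  where
  m = suc (length c)

  base′ : ∀ {x} → 1 ≤ x → x < m → x ∈ extension c
  base′ {suc x} _ (s≤s x<n) = from (∈-extension⇔ c)
    (fromℕ< x<n , 0 , All.lookup c⁺ (∈-lookup (fromℕ< x<n)) ,
     cong suc (sym (trans (+-identityʳ _) (toℕ-fromℕ< x<n))))

  residue′ : ∀ {x} → x ∈ extension c → ∃[ r ] ∃[ j ] (1 ≤ r × r < m × x ≡ r + j * m)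
  residue′ x∈ with i , j , _ , eq ← to (∈-extension⇔ c) x∈ =
    suc (toℕ i) , j , s≤s z≤n , s≤s (toℕ<n i) , eq

  down′ : ∀ {x} → x ∈ extension c → m ≤ x → x ∸ m ∈ extension c
  down′ x∈ m≤x with to (∈-extension⇔ c) x∈
  ... | i , zero , _ , refl =
    ⊥-elim (<⇒≱ (subst (_< m) (sym (+-identityʳ _)) (s≤s (toℕ<n i))) m≤x)
  ... | i , suc j , 1+j<ci , refl = from (∈-extension⇔ c)
    (i , j , <-trans (n<1+n j) 1+j<ci , n+[m+o]∸m≡n+o m (suc (toℕ i)) (j * m))

∈-extension-column : ∀ c (i : Fin (length c)) j →
                     (suc (toℕ i) + j * suc (length c) ∈ extension c) ⇔ (j < lookup c i)
∈-extension-column c i j = mk⇔ column⁻ λ j<ci → from (∈-extension⇔ c) (i , j , j<ci , refl)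
  where
  column⁻ : suc (toℕ i) + j * suc (length c) ∈ extension c → j < lookup c i
  column⁻ x∈ with i′ , j′ , j′<ci′ , eq ← to (∈-extension⇔ c) x∈
    with i≡i′ , refl ← quotRem-injective j j′ (s≤s (toℕ<n i)) (s≤s (toℕ<n i′)) eq
    rewrite toℕ-injective (suc-injective i≡i′) = j′<ci′

extension≡⇒<lookup : ∀ d d′ i i′ {j} → extension d ≡ extension d′ → length d ≡ length d′ →
                     toℕ i ≡ toℕ i′ → j < lookup d i → j < lookup d′ i′
extension≡⇒<lookup d d′ i i′ {j} eq |d|≡|d′| i≡i′ j<di =
  to (∈-extension-column d′ i′ j)
     (subst₂ _∈_ (cong₂ (λ a b → suc a + j * suc b) i≡i′ |d|≡|d′|) eq
                 (from (∈-extension-column d i j) j<di))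

extension-injective : ∀ {c c′} → All (1 ≤_) c → All (1 ≤_) c′ →
                      extension c ≡ extension c′ → c ≡ c′
extension-injective {c} {c′} c⁺ c′⁺ eq = Pointwise-≡⇒≡ (lookup⁻ |c|≡|c′| lookup≡)
  where
  |c|≡|c′| : length c ≡ length c′
  |c|≡|c′| = suc-injective (Stacked-modulus-unique (s≤s z≤n) (s≤s z≤n)
    (extension-stacked c⁺) (subst (Stacked _) (sym eq) (extension-stacked c′⁺)))

  lookup≡ : ∀ {i i′} → toℕ i ≡ toℕ i′ → lookup c i ≡ lookup c′ i′
  lookup≡ {i} {i′} i≡i′ = <-⇔-injective λ j →
    mk⇔ (extension≡⇒<lookup c c′ i i′ eq |c|≡|c′| i≡i′)
        (extension≡⇒<lookup c′ c i′ i (sym eq) (sym |c|≡|c′|) (sym i≡i′))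

Stacked-columnHeight : ∀ {m A} .{{_ : NonZero m}} → Stacked m A →
                       ∀ r → ∃[ h ] (∀ j → (r + j * m ∈ A) ⇔ (j < h))
Stacked-columnHeight {m} {A} S r =
  initialSegment (λ j → r + j * m ∈ A) (λ j → r + j * m ∈? A) (λ {j} → down′ {j})
                 (suc (max 0 A)) (λ {j} → bounded {j})
  where
  down′ : ∀ {j} → r + suc j * m ∈ A → r + j * m ∈ A
  down′ {j} x∈ = subst (_∈ A) (n+[m+o]∸m≡n+o m r (j * m))
    (down S x∈ (≤-trans (m≤m+n m (j * m)) (m≤n+m _ r)))

  bounded : ∀ {j} → r + j * m ∈ A → j < suc (max 0 A)
  bounded {j} x∈ = s≤s (≤-trans (m≤m*n j m) (≤-trans (m≤n+m (j * m) r) (All.lookup (xs≤max 0 A) x∈)))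

Stacked⇒≡extension : ∀ {n A} → Linked _<_ A → Stacked (suc n) A →
                     ∃[ c ] (All (1 ≤_) c × A ≡ extension c)
Stacked⇒≡extension {n} {A} A↗ S = c , c⁺ , strictlySorted-ext A↗ (extension-strictlySorted c) A⇔
  where
  m = suc n

  height : ℕ → ℕ
  height i = proj₁ (Stacked-columnHeight S (suc i))

  height-spec : ∀ i j → (suc i + j * m ∈ A) ⇔ (j < height i)
  height-spec i = proj₂ (Stacked-columnHeight S (suc i))

  c : List ℕ
  c = applyUpTo height n

  c⁺ : All (1 ≤_) c
  c⁺ = All.applyUpTo⁺₁ height n λ {i} i<n →
    to (height-spec i 0) (subst (_∈ A) (sym (+-identityʳ (suc i))) (base S (s≤s z≤n) (s≤s i<n)))

  |c|≡n : length c ≡ n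
  |c|≡n = length-applyUpTo height n

  cell≡ : ∀ i j → suc i + j * suc (length c) ≡ suc i + j * m
  cell≡ i j = cong (λ l → suc i + j * suc l) |c|≡n

  A⇔ : ∀ x → (x ∈ A) ⇔ (x ∈ extension c)
  A⇔ x = mk⇔ (from (∈-extension⇔ c) ∘ toColumns) (fromColumns ∘ to (∈-extension⇔ c))
    where
    toColumns : x ∈ A → InColumns (suc (length c)) 1 c x
    toColumns x∈A with residue S x∈A
    ... | suc i , j , _ , s≤s i<n , refl =
      k , j , j<ck , trans (cong (λ l → suc l + j * m) (sym (toℕ-fromℕ< i<|c|))) (sym (cell≡ (toℕ k) j))
      where
      i<|c| : i < length c
      i<|c| = subst (i <_) (sym |c|≡n) i<n
      k : Fin (length c)
      k = fromℕ< i<|c|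
      j<ck : j < lookup c k
      j<ck = subst (j <_) (sym (trans (lookup-applyUpTo height n k) (cong height (toℕ-fromℕ< i<|c|))))
                   (to (height-spec i j) x∈A)
    fromColumns : InColumns (suc (length c)) 1 c x → x ∈ A
    fromColumns (k , j , j<ck , refl) = subst (_∈ A) (sym (cell≡ (toℕ k) j))
      (from (height-spec (toℕ k) j) (subst (j <_) (lookup-applyUpTo height n k) j<ck))

extension-isExtension : ∀ {k ks} → All (1 ≤_) (k ∷ ks) → IsExtension (extension (k ∷ ks))
extension-isExtension c⁺ = _ , s≤s (s≤s z≤n) , Stacked⇒IsMExtension (extension-stacked c⁺)

isExtension⇒≡extension : ∀ {A} → Linked _<_ A → IsExtension A →
                         ∃[ c ] (All (1 ≤_) c × A ≡ extension c)
isExtension⇒≡extension A↗ (suc _ , _ , A-ext) = Stacked⇒≡extension A↗ (IsMExtension⇒Stacked A-ext)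

corollary4p2 : (g : ℕ) → 1 ≤ g →
    Σ (List (List ℕ)) λ L →
      All IsFinSet L × Unique L × length L ≡ 2 ^ (g ∸ 1) ×
      ((A : List ℕ) → IsFinSet A → ((A ∈ L) ⇔ (IsExtension A × genus A ≡ g)))
corollary4p2 g 1≤g =
  map extension (compositions g) ,
  All.map⁺ (All.tabulate λ {c} _ → extension-isFinSet c) ,
  Unique-map⁺ extension-injective (All.map proj₁ (compositions-isComposition g)) (compositions-unique g) ,
  trans (length-map extension (compositions g)) (length-compositions g) ,
  λ A (_ , A↗) → mk⇔ (sound ∘ ∈-map⁻ extension) (complete A↗)
  where
  sound : ∀ {A} → ∃[ c ] (c ∈ compositions g × A ≡ extension c) → IsExtension A × genus A ≡ g
  sound (c , c∈ , refl) with All.lookup (compositions-isComposition g) c∈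
  ... | []        , sum≡ = ⊥-elim (<-irrefl sum≡ 1≤g)
  ... | c⁺@(_ ∷ _) , sum≡ = extension-isExtension c⁺ , trans (length-extension c) sum≡

  complete : ∀ {A} → Linked _<_ A → IsExtension A × genus A ≡ g → A ∈ map extension (compositions g)
  complete A↗ (A-ext , genus≡) with c , c⁺ , refl ← isExtension⇒≡extension A↗ A-ext =
    ∈-map⁺ extension (∈-compositions⁺ g (c⁺ , trans (sym (length-extension c)) genus≡))
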